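{- If $f\in\#\mathsf{FA}$, then for every $c\in\mathbb{N}$ the function $w\mapsto\max(f(w)-c,0)$ is in $\#\mathsf{FA}$.
   Context: $\mathbb{N}=\{0,1,2,\dots\}$. An NFA is a tuple $M=(Q,\Sigma,\mathrm{wt},\mathrm{in},\mathrm{out})$ with $Q,\Sigma$ finite, $\mathrm{wt}:Q\times\Sigma\times Q\to\mathbb{N}$, $\mathrm{in},\mathrm{out}:Q\to\mathbb{N}$; on input $w=w_1\cdots w_n$ it outputs $\sum_{q_0,\dots,q_n\in Q}\mathrm{in}(q_0)\prod_{i=1}^n\mathrm{wt}(q_{i-1},w_i,q_i)\mathrm{out}(q_n)$. $\#\mathsf{FA}$ is the set of functions $\Sigma^\star\to\mathbb{N}$ (over finite alphabets $\Sigma$) computed by NFAs. -}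

module Defs where

open import Data.Nat using (ℕ; zero; suc; _+_; _*_; _∸_)
open import Data.Fin using (Fin; zero; suc)
open import Data.List using (List; []; _∷_)
open import Data.Product using (∃; ∃-syntax; Σ-syntax)
open import Relation.Binary.PropositionalEquality using (_≡_)

∑ : (n : ℕ) → (Fin n → ℕ) → ℕ
∑ zero    f = 0
∑ (suc n) f = f zero + ∑ n (λ i → f (suc i))

record NFA (s : ℕ) : Set where
  field
    k   : ℕ
    wt  : Fin k → Fin s → Fin k → ℕ
    in′ : Fin k → ℕ
    out : Fin k → ℕ

-- Sum over all state sequences q₀ … qₙ (n = length w) of
-- in(q₀) · ∏ wt(q_{i-1}, w_i, q_i) · out(qₙ), written as nested sums:
-- paths M q w = ∑_{q₁…qₙ} ∏ wt(q_{i-1},w_i,q_i) · out(qₙ) with q₀ = q.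
paths : ∀ {s} (M : NFA s) → Fin (NFA.k M) → List (Fin s) → ℕ
paths M q []      = NFA.out M q
paths M q (a ∷ w) = ∑ (NFA.k M) (λ q′ → NFA.wt M q a q′ * paths M q′ w)

run : ∀ {s} (M : NFA s) → List (Fin s) → ℕ
run M w = ∑ (NFA.k M) (λ q₀ → NFA.in′ M q₀ * paths M q₀ w)

#FA : ∀ {s} → (List (Fin s) → ℕ) → Set
#FA {s} f = Σ[ M ∈ NFA s ] (∀ w → run M w ≡ f w)

-- It suffices to treat c = 1. Write P(q, w) for the total weight of the paths of M from
-- q on w, so f(w) = Σ_q in(q) P(q, w) and P(q, aw) = Σ_q′ wt(q, a, q′) P(q′, w).
-- For vectors u, p one has  Σ u_i p_i ∸ 1 = Σ_{i≠h} u_i p_i + u_h (p_h ∸ 1) + (u_h ∸ 1)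
-- for the first index h with u_h p_h > 0, and = Σ u_i p_i when there is none; h depends
-- only on u and the support of p. Hence the quantities P(q, w), P(q, w) ∸ 1 and 1 satisfy
-- a linear recursion over w whose coefficients depend on the support of P(·, w). That
-- support is computed from w by a deterministic automaton reading w from right to left,
-- and a product with such an automaton turns support-dependent weights into ordinary ones.
module Submission where

open import Defs
open import Data.Bool using (Bool; true; false; _∧_; _∨_; if_then_else_)
open import Data.Fin using (Fin; zero; suc; _↑ˡ_; _↑ʳ_; splitAt; combine; remQuot)
open import Data.Fin.Properties using (splitAt-↑ˡ; splitAt-↑ʳ; remQuot-combine)
open import Data.List using (List; []; _∷_; foldr)
open import Data.Nat using (ℕ; zero; suc; _+_; _*_; _∸_; _^_; _<ᵇ_)
open import Data.Nat.Properties
  using (+-identityʳ; +-assoc; *-assoc; *-zeroʳ; *-distribˡ-+; ∸-+-assoc; *-commutativeSemigroup)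
open import Data.Nat.Solver using (module +-*-Solver)
open import Data.Product using (_×_; _,_; proj₁; proj₂)
open import Data.Sum using ([_,_])
open import Data.Vec using (Vec; []; _∷_; tabulate)
open import Data.Vec.Properties using (tabulate-cong)
open import Data.Vec.Functional using () renaming (_∷_ to _◂_)
open import Function using (_∘_)
open import Relation.Binary.PropositionalEquality
  using (_≡_; refl; sym; trans; cong; cong₂; module ≡-Reasoning)
open ≡-Reasoning
open +-*-Solver
open import Algebra.Properties.CommutativeSemigroup *-commutativeSemigroup using (x∙yz≈y∙xz)

∑-cong : ∀ n {f g : Fin n → ℕ} → (∀ i → f i ≡ g i) → ∑ n f ≡ ∑ n g
∑-cong zero    f≗g = refl
∑-cong (suc n) f≗g = cong₂ _+_ (f≗g zero) (∑-cong n (f≗g ∘ suc))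

∑-zero : ∀ n → ∑ n (λ _ → 0) ≡ 0
∑-zero zero    = refl
∑-zero (suc n) = ∑-zero n

*-distribˡ-∑ : ∀ n c (f : Fin n → ℕ) → c * ∑ n f ≡ ∑ n (λ i → c * f i)
*-distribˡ-∑ zero    c f = *-zeroʳ c
*-distribˡ-∑ (suc n) c f =
  trans (*-distribˡ-+ c (f zero) _) (cong (c * f zero +_) (*-distribˡ-∑ n c (f ∘ suc)))

∑-+ : ∀ m n (f : Fin (m + n) → ℕ) → ∑ (m + n) f ≡ ∑ m (f ∘ (_↑ˡ n)) + ∑ n (f ∘ (m ↑ʳ_))
∑-+ zero    n f = refl
∑-+ (suc m) n f = trans (cong (f zero +_) (∑-+ m n (f ∘ suc))) (sym (+-assoc (f zero) _ _))

∑-* : ∀ m n (f : Fin (m * n) → ℕ) → ∑ (m * n) f ≡ ∑ m (λ i → ∑ n (f ∘ combine i))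
∑-* zero    n f = refl
∑-* (suc m) n f =
  trans (∑-+ n (m * n) f) (cong (∑ n (f ∘ (_↑ˡ m * n)) +_) (∑-* m n (f ∘ (n ↑ʳ_))))

∑-remQuot : ∀ m n (g : Fin m × Fin n → ℕ) →
            ∑ (m * n) (g ∘ remQuot n) ≡ ∑ m (λ i → ∑ n (λ j → g (i , j)))
∑-remQuot m n g =
  trans (∑-* m n (g ∘ remQuot n))
        (∑-cong m (λ i → ∑-cong n (λ j → cong g (remQuot-combine i j))))

δ : ∀ {m} → Fin m → Fin m → ℕ
δ zero    zero    = 1
δ zero    (suc _) = 0
δ (suc _) zero    = 0
δ (suc i) (suc j) = δ i j

∑-δ : ∀ {m} (j : Fin m) (h : Fin m → ℕ) → ∑ m (λ i → δ i j * h i) ≡ h j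
∑-δ {suc m} zero    h = trans (cong₂ _+_ (+-identityʳ (h zero)) (∑-zero m)) (+-identityʳ (h zero))
∑-δ {suc m} (suc j) h = ∑-δ j (h ∘ suc)

#FA-cong : ∀ {s} {f g : List (Fin s) → ℕ} → (∀ w → f w ≡ g w) → #FA f → #FA g
#FA-cong f≗g (M , M≗f) = M , λ w → trans (M≗f w) (f≗g w)

-- An automaton whose weights may depend on a label of the unread suffix, computed by a
-- deterministic automaton on Fin m reading from right to left; elem need not be injective.
module Lookahead {s m n : ℕ} {X : Set} (elem : Fin n → X)
  (step : Fin s → Fin m → Fin m) (start : Fin m)
  (wt : Fin m → X → Fin s → X → ℕ) (init : Fin m → X → ℕ) (final : X → ℕ) where

  ∑X : (X → ℕ) → ℕ
  ∑X g = ∑ n (g ∘ elem)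

  label : List (Fin s) → Fin m
  label = foldr step start

  weight : X → List (Fin s) → ℕ
  weight x []      = final x
  weight x (a ∷ w) = ∑X (λ x′ → wt (label w) x a x′ * weight x′ w)

  value : List (Fin s) → ℕ
  value w = ∑X (λ x → init (label w) x * weight x w)

  labelOf : Fin (m * n) → Fin m
  labelOf i = proj₁ (remQuot {m} n i)

  stateOf : Fin (m * n) → X
  stateOf i = elem (proj₂ (remQuot {m} n i))

  product : NFA s
  product = record
    { k   = m * n
    ; wt  = λ i a j → δ (labelOf i) (step a (labelOf j)) * wt (labelOf j) (stateOf i) a (stateOf j)
    ; in′ = λ i → init (labelOf i) (stateOf i)
    ; out = λ i → δ (labelOf i) start * final (stateOf i)
    }

  ∑-product-δ : ∀ t (g : Fin m → X → ℕ) (v : X → ℕ) →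
                ∑ (m * n) (λ i → g (labelOf i) (stateOf i) * (δ (labelOf i) t * v (stateOf i)))
                ≡ ∑X (λ x → g t x * v x)
  ∑-product-δ t g v = begin
    ∑ (m * n) (λ i → g (labelOf i) (stateOf i) * (δ (labelOf i) t * v (stateOf i)))
      ≡⟨ ∑-remQuot m n (λ yj →
           g (proj₁ yj) (elem (proj₂ yj)) * (δ (proj₁ yj) t * v (elem (proj₂ yj)))) ⟩
    ∑ m (λ y → ∑ n (λ j → g y (elem j) * (δ y t * v (elem j))))
      ≡⟨ ∑-cong m (λ y → ∑-cong n (λ j → x∙yz≈y∙xz (g y (elem j)) (δ y t) (v (elem j)))) ⟩
    ∑ m (λ y → ∑ n (λ j → δ y t * (g y (elem j) * v (elem j))))
      ≡⟨ ∑-cong m (λ y → sym (*-distribˡ-∑ n (δ y t) _)) ⟩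
    ∑ m (λ y → δ y t * ∑X (λ x → g y x * v x))
      ≡⟨ ∑-δ t _ ⟩
    ∑X (λ x → g t x * v x) ∎

  paths-product : ∀ w i → paths product i w ≡ δ (labelOf i) (label w) * weight (stateOf i) w
  paths-product []      i = refl
  paths-product (a ∷ w) i = begin
    ∑ (m * n) (λ j → NFA.wt product i a j * paths product j w)
      ≡⟨ ∑-cong (m * n) (λ j → cong (NFA.wt product i a j *_) (paths-product w j)) ⟩
    ∑ (m * n) (λ j → NFA.wt product i a j * (δ (labelOf j) (label w) * weight (stateOf j) w))
      ≡⟨ ∑-product-δ (label w) (λ y x → δ (labelOf i) (step a y) * wt y (stateOf i) a x)
                     (λ x → weight x w) ⟩
    ∑X (λ x → d * wt (label w) (stateOf i) a x * weight x w)
      ≡⟨ ∑-cong n (λ j → *-assoc d _ _) ⟩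
    ∑X (λ x → d * (wt (label w) (stateOf i) a x * weight x w))
      ≡⟨ sym (*-distribˡ-∑ n d _) ⟩
    d * weight (stateOf i) (a ∷ w) ∎
    where d = δ (labelOf i) (label (a ∷ w))

  value-#FA : #FA value
  value-#FA = product , λ w →
    trans (∑-cong (m * n) (λ i → cong (NFA.in′ product i *_) (paths-product w i)))
          (∑-product-δ (label w) init (λ x → weight x w))

bit : Bool → Fin 2
bit false = zero
bit true  = suc zero

encode : ∀ {k} → Vec Bool k → Fin (2 ^ k)
encode []      = zero
encode (b ∷ v) = combine (bit b) (encode v)

decode : ∀ {k} → Fin (2 ^ k) → Vec Bool k
decode {zero}  _ = []
decode {suc k} i with remQuot {2} (2 ^ k) i
... | zero     , j = false ∷ decode j
... | suc zero , j = true ∷ decode j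

decode-encode : ∀ {k} (v : Vec Bool k) → decode (encode v) ≡ v
decode-encode []                = refl
decode-encode {suc k} (b ∷ v) rewrite remQuot-combine {2} {2 ^ k} (bit b) (encode v) with b
... | false = cong (false ∷_) (decode-encode v)
... | true  = cong (true ∷_) (decode-encode v)

positive : ∀ {n} → (Fin n → ℕ) → Vec Bool n
positive p = tabulate (λ i → 0 <ᵇ p i)

meets : ∀ {n} → (Fin n → ℕ) → Vec Bool n → Bool
meets u []      = false
meets u (b ∷ r) = ((0 <ᵇ u zero) ∧ b) ∨ meets (u ∘ suc) r

0<ᵇ-+ : ∀ x y → (0 <ᵇ x + y) ≡ ((0 <ᵇ x) ∨ (0 <ᵇ y))
0<ᵇ-+ zero    y = refl
0<ᵇ-+ (suc x) y = refl

0<ᵇ-* : ∀ x y → (0 <ᵇ x * y) ≡ ((0 <ᵇ x) ∧ (0 <ᵇ y))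
0<ᵇ-* zero    y       = refl
0<ᵇ-* (suc x) zero    = cong (0 <ᵇ_) (*-zeroʳ x)
0<ᵇ-* (suc x) (suc y) = refl

0<ᵇ-∑ : ∀ n (u p : Fin n → ℕ) → (0 <ᵇ ∑ n (λ i → u i * p i)) ≡ meets u (positive p)
0<ᵇ-∑ zero    u p = refl
0<ᵇ-∑ (suc n) u p =
  trans (0<ᵇ-+ (u zero * p zero) _)
        (cong₂ _∨_ (0<ᵇ-* (u zero) (p zero)) (0<ᵇ-∑ n (u ∘ suc) (p ∘ suc)))

-- States of the automaton for f ∸ 1: copies of the states of M weighted by P and by
-- P ∸ 1, and one state of constant weight 1 (see extend).
data Ext (k : ℕ) : Set where
  exact dec : Fin k → Ext k
  one       : Ext k

ΣExt : ∀ k → (Ext k → ℕ) → ℕ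
ΣExt k g = g one + (∑ k (g ∘ exact) + ∑ k (g ∘ dec))

enumExt : ∀ {k} → Fin (suc (k + k)) → Ext k
enumExt     zero    = one
enumExt {k} (suc i) = [ exact , dec ] (splitAt k i)

∑-enumExt : ∀ k (g : Ext k → ℕ) → ∑ (suc (k + k)) (g ∘ enumExt) ≡ ΣExt k g
∑-enumExt k g = cong (g one +_) (trans (∑-+ k k (g ∘ enumExt ∘ suc))
  (cong₂ _+_ (∑-cong k (λ q → cong (g ∘ [ exact , dec ]) (splitAt-↑ˡ k q k)))
             (∑-cong k (λ q → cong (g ∘ [ exact , dec ]) (splitAt-↑ʳ k k q)))))

extend : ∀ {k} → (Fin k → ℕ) → Ext k → ℕ
extend p (exact q) = p q
extend p (dec q)   = p q ∸ 1
extend p one       = 1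

decrementHead : ∀ {n} → ℕ → (Fin n → ℕ) → Ext (suc n) → ℕ
decrementHead u₀ u (exact zero)    = 0
decrementHead u₀ u (exact (suc q)) = u q
decrementHead u₀ u (dec zero)      = u₀
decrementHead u₀ u (dec (suc q))   = 0
decrementHead u₀ u one             = u₀ ∸ 1

keepHead : ∀ {n} → ℕ → (Ext n → ℕ) → Ext (suc n) → ℕ
keepHead u₀ c (exact zero)    = u₀
keepHead u₀ c (exact (suc q)) = c (exact q)
keepHead u₀ c (dec zero)      = 0
keepHead u₀ c (dec (suc q))   = c (dec q)
keepHead u₀ c one             = c one

decrement : ∀ {n} → (Fin n → ℕ) → Vec Bool n → Ext n → ℕ
decrement u []      = λ _ → 0
decrement u (b ∷ r) =
  if (0 <ᵇ u zero) ∧ b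
  then decrementHead (u zero) (u ∘ suc)
  else keepHead (u zero) (decrement (u ∘ suc) r)

decrementHead-correct : ∀ n a b (u p : Fin n → ℕ) →
  ΣExt (suc n) (λ x → decrementHead (suc a) u x * extend (suc b ◂ p) x)
  ≡ ∑ (suc n) (λ i → (suc a ◂ u) i * (suc b ◂ p) i) ∸ 1
decrementHead-correct n a b u p rewrite ∑-zero n = arith a b (∑ n (λ i → u i * p i))
  where
  arith : ∀ a b S → a * 1 + (S + (suc a * b + 0)) ≡ (suc a * suc b + S) ∸ 1
  arith = solve 3 (λ a b S → a :* con 1 :+ (S :+ ((con 1 :+ a) :* b :+ con 0))
                         := b :+ a :* (con 1 :+ b) :+ S) refl

keepHead-correct : ∀ n u₀ p₀ (u p : Fin n → ℕ) → u₀ * p₀ ≡ 0 →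
  ΣExt n (λ x → decrement u (positive p) x * extend p x) ≡ ∑ n (λ i → u i * p i) ∸ 1 →
  ΣExt (suc n) (λ x → keepHead u₀ (decrement u (positive p)) x * extend (p₀ ◂ p) x)
  ≡ ∑ (suc n) (λ i → (u₀ ◂ u) i * (p₀ ◂ p) i) ∸ 1
keepHead-correct n u₀ p₀ u p u₀p₀≡0 IH rewrite u₀p₀≡0 = IH

decrement-correct : ∀ {n} (u p : Fin n → ℕ) →
  ΣExt n (λ x → decrement u (positive p) x * extend p x) ≡ ∑ n (λ i → u i * p i) ∸ 1
decrement-correct {zero}  u p = refl
decrement-correct {suc n} u p with u zero | p zero
... | zero  | p₀    =
  keepHead-correct n 0 p₀ (u ∘ suc) (p ∘ suc) refl (decrement-correct (u ∘ suc) (p ∘ suc))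
... | suc a | zero  =
  keepHead-correct n (suc a) 0 (u ∘ suc) (p ∘ suc) (*-zeroʳ a) (decrement-correct (u ∘ suc) (p ∘ suc))
... | suc a | suc b = decrementHead-correct n a b (u ∘ suc) (p ∘ suc)

module Predecessor {s} (M : NFA s) where
  open NFA M

  P : List (Fin s) → Fin k → ℕ
  P w q = paths M q w

  support : List (Fin s) → Vec Bool k
  support w = positive (P w)

  supportStep : Fin s → Vec Bool k → Vec Bool k
  supportStep a r = tabulate (λ q → meets (wt q a) r)

  support-∷ : ∀ a w → support (a ∷ w) ≡ supportStep a (support w)
  support-∷ a w = tabulate-cong (λ q → 0<ᵇ-∑ k (wt q a) (P w))

  exactRow : (Fin k → ℕ) → Ext k → ℕ
  exactRow u (exact q) = u q
  exactRow u _         = 0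

  oneRow : Ext k → ℕ
  oneRow one = 1
  oneRow _   = 0

  row : Vec Bool k → Ext k → Fin s → Ext k → ℕ
  row r (exact q) a = exactRow (wt q a)
  row r (dec q)   a = decrement (wt q a) r
  row r one       a = oneRow

  row-correct : ∀ x a w →
    ΣExt k (λ x′ → row (support w) x a x′ * extend (P w) x′) ≡ extend (P (a ∷ w)) x
  row-correct (exact q) a w = trans (cong (P (a ∷ w) q +_) (∑-zero k)) (+-identityʳ _)
  row-correct (dec q)   a w = decrement-correct (wt q a) (P w)
  row-correct one       a w = cong suc (cong₂ _+_ (∑-zero k) (∑-zero k))

  open Lookahead enumExt (λ a y → encode (supportStep a (decode y))) (encode (support []))
                 (row ∘ decode) (decrement in′ ∘ decode) (extend out) public

  decode-label : ∀ w → decode (label w) ≡ support w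
  decode-label []      = decode-encode (support [])
  decode-label (a ∷ w) =
    trans (decode-encode _) (trans (cong (supportStep a) (decode-label w)) (sym (support-∷ a w)))

  mutual
    weight-correct : ∀ x w → weight x w ≡ extend (P w) x
    weight-correct x []      = refl
    weight-correct x (a ∷ w) = trans (∑X-on-support (λ r → row r x a) w) (row-correct x a w)

    ∑X-on-support : ∀ (c : Vec Bool k → Ext k → ℕ) w →
      ∑X (λ x → c (decode (label w)) x * weight x w)
      ≡ ΣExt k (λ x → c (support w) x * extend (P w) x)
    ∑X-on-support c w = trans
      (∑-cong (suc (k + k)) (λ j →
        cong₂ (λ r v → c r (enumExt j) * v) (decode-label w) (weight-correct (enumExt j) w)))
      (∑-enumExt k (λ x → c (support w) x * extend (P w) x))

  value-correct : ∀ w → value w ≡ run M w ∸ 1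
  value-correct w = trans (∑X-on-support (decrement in′) w) (decrement-correct in′ (P w))

predecessor-#FA : ∀ {s} (f : List (Fin s) → ℕ) → #FA f → #FA (λ w → f w ∸ 1)
predecessor-#FA f (M , M≗f) =
  #FA-cong (λ w → trans (value-correct w) (cong (_∸ 1) (M≗f w))) value-#FA
  where open Predecessor M

lemma6 : ∀ {s : ℕ} (f : List (Fin s) → ℕ) → #FA f → (c : ℕ) → #FA (λ w → f w ∸ c)
lemma6 f f∈#FA zero    = f∈#FA
lemma6 f f∈#FA (suc c) =
  #FA-cong (λ w → ∸-+-assoc (f w) 1 c) (lemma6 (λ w → f w ∸ 1) (predecessor-#FA f f∈#FA) c)
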